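{- Let $T$ and $T'$ be $r$-ary GDH theories such that $J_{T'} \subseteq J_T$, and let $\alpha$ be a demonstrated nonjump for $T$. Then $\frac{k m_{T'}}{m_T}\alpha$ is a demonstrated nonjump for $T'$ for each $k = 1, \ldots, \frac{m_T}{m_{T'}}$.
   Context: For an integer $r \geq 2$ and a subgroup $J \subseteq S_r$, a GDH theory $T$ is given by $J_T = J$, with $m_T := |J_T|$. A $T$-graph $G$ is a finite set $V_G$ with a relation $E_G \subseteq V_G^r$ such that every tuple in $E_G$ has pairwise distinct entries and $E_G$ is closed under permuting coordinates by elements of $J_T$. An edge is an orbit of $E_G$ under this $J_T$-action. For $G$ on vertex set $\{1,\ldots,n\}$ and an $r$-subset $R$, let $e_R$ be the number of edges whose entries form the set $R$; $p_G(x) = \sum_R e_R \prod_{i \in R} x_i$ and the blowup density is $b_T(G) = m_T \max\{p_G(x): x_i \ge 0, \sum_i x_i = 1\}$. $\alpha \in [0,1)$ is a demonstrated nonjump for $T$ if there is an infinite sequence of $T$-graphs $\{G_n\}$ with $b_T(G_n) > \alpha$ for each $n$, such that for every positive integer $l$ there is $n_0$ so that for all $n \geq n_0$, every sub-$T$-graph $H \subseteq G_n$ on at most $l$ vertices has $b_T(H) \leq \alpha$. -}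

module Defs where

open import Data.Nat as ℕ using (ℕ; zero; suc; _≤_)
open import Data.Integer using (+_)
open import Data.Rational as ℚ using (ℚ; 0ℚ; 1ℚ)
open import Data.Bool using (Bool; true; false; T; _∧_; if_then_else_)
open import Data.Fin as Fin using (Fin)
open import Data.Vec as Vec using (Vec; []; _∷_; lookup; tabulate)
open import Data.Vec.Properties using (≡-dec)
open import Data.List as List using (List; [_]; concatMap; allFin; filter; length)
open import Data.Product using (Σ; ∃; _×_; _,_; proj₁; proj₂)
open import Relation.Nullary using (¬_)
open import Relation.Nullary.Decidable using (⌊_⌋)
open import Relation.Binary.PropositionalEquality using (_≡_)
open import Function.Definitions using (Injective)

allTuples : (n r : ℕ) → List (Vec (Fin n) r)
allTuples n zero    = [ [] ]
allTuples n (suc r) = concatMap (λ i → List.map (i ∷_) (allTuples n r)) (allFin n)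

allSubsets : (n : ℕ) → List (Vec Bool n)
allSubsets zero    = [ [] ]
allSubsets (suc n) = concatMap (λ b → List.map (b ∷_) (allSubsets n)) (true List.∷ false List.∷ List.[])

count : {A : Set} → (A → Bool) → List A → ℕ
count p xs = length (List.filter (λ x → T? (p x)) xs)
  where
  open import Data.Bool using (T?)

card : {n : ℕ} → Vec Bool n → ℕ
card []          = 0
card (true ∷ b)  = suc (card b)
card (false ∷ b) = card b

_==ᵥ_ : {n r : ℕ} → Vec (Fin n) r → Vec (Fin n) r → Bool
u ==ᵥ v = ⌊ ≡-dec Fin._≟_ u v ⌋

_==ₛ_ : {n : ℕ} → Vec Bool n → Vec Bool n → Bool
u ==ₛ v = ⌊ ≡-dec Data.Bool._≟_ u v ⌋
  where import Data.Bool

anyL : {A : Set} → (A → Bool) → List A → Bool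
anyL p xs = List.foldr (λ x b → p x Data.Bool.∨ b) false xs
  where import Data.Bool

-- Permutations of Fin r, represented as vectors σ (i ↦ lookup σ i)

Perm : ℕ → Set
Perm r = Vec (Fin r) r

IsPerm : {r : ℕ} → Perm r → Set
IsPerm σ = Injective _≡_ _≡_ (lookup σ)

idPerm : (r : ℕ) → Perm r
idPerm r = tabulate (λ i → i)

_∘ₚ_ : {r : ℕ} → Perm r → Perm r → Perm r
σ ∘ₚ τ = tabulate (λ i → lookup σ (lookup τ i))

-- An r-ary GDH theory: a subgroup J of S_r (membership decidable, as Bool).
-- For a finite set of permutations, containing the identity and being
-- closed under composition is equivalent to being a subgroup.
record GDH (r : ℕ) : Set where
  field
    J      : Perm r → Bool
    J-perm : ∀ σ → T (J σ) → IsPerm σ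
    J-id   : T (J (idPerm r))
    J-comp : ∀ σ τ → T (J σ) → T (J τ) → T (J (σ ∘ₚ τ))
open GDH public

mT : {r : ℕ} → GDH r → ℕ
mT {r} Th = count (J Th) (allTuples r r)

act : {n r : ℕ} → Vec (Fin n) r → Perm r → Vec (Fin n) r
act t σ = tabulate (λ i → lookup t (lookup σ i))

record TGraph {r : ℕ} (Th : GDH r) (n : ℕ) : Set where
  field
    E          : Vec (Fin n) r → Bool
    E-distinct : ∀ t → T (E t) → Injective _≡_ _≡_ (lookup t)
    E-closed   : ∀ t σ → T (E t) → T (J Th σ) → T (E (act t σ))
open TGraph public

orbitSize : {r n : ℕ} → GDH r → Vec (Fin n) r → ℕ
orbitSize {r} {n} Th t =
  count (λ u → anyL (λ σ → J Th σ ∧ (u ==ᵥ act t σ)) (allTuples r r)) (allTuples n r)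

entrySet : {n r : ℕ} → Vec (Fin n) r → Vec Bool n
entrySet {n} {r} t = tabulate (λ v → anyL (λ i → ⌊ v Fin.≟ lookup t i ⌋) (allFin r))

inv : ℕ → ℚ
inv zero    = 0ℚ
inv (suc k) = + 1 ℚ./ suc k

sumℚ : List ℚ → ℚ
sumℚ = List.foldr ℚ._+_ 0ℚ

-- e_R = number of edges (J-orbits in E) whose entries form the set R;
-- counted as the sum over tuples t ∈ E with entry set R of 1/|orbit(t)|.
edgeCount : {r n : ℕ} {Th : GDH r} → TGraph Th n → Vec Bool n → ℚ
edgeCount {r} {n} {Th} G R =
  sumℚ (List.map (λ t → if E G t ∧ (entrySet t ==ₛ R) then inv (orbitSize Th t) else 0ℚ)
                 (allTuples n r))

prodOn : {n : ℕ} → Vec Bool n → (Fin n → ℚ) → ℚ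
prodOn {n} R x = List.foldr ℚ._*_ 1ℚ
  (List.map (λ i → if lookup R i then x i else 1ℚ) (allFin n))

polyG : {r n : ℕ} {Th : GDH r} → TGraph Th n → (Fin n → ℚ) → ℚ
polyG {r} {n} G x =
  sumℚ (List.map (λ R → if ⌊ card R ℕ.≟ r ⌋ then edgeCount G R ℚ.* prodOn R x else 0ℚ)
                 (allSubsets n))

blowupAt : {r n : ℕ} {Th : GDH r} → TGraph Th n → (Fin n → ℚ) → ℚ
blowupAt {Th = Th} G x = (+ mT Th ℚ./ 1) ℚ.* polyG G x

InSimplex : {n : ℕ} → (Fin n → ℚ) → Set
InSimplex {n} x = (∀ i → 0ℚ ℚ.≤ x i) × (sumℚ (List.map x (allFin n)) ≡ 1ℚ)

-- Real numbers α ∈ [0,1), represented by their upper cut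
-- U = { q ∈ ℚ : α < q }  (an open, rounded, upward-closed set).

record UpperCut01 (U : ℚ → Set) : Set where
  field
    rounded  : ∀ q → U q → Σ ℚ λ q' → q' ℚ.< q × U q'
    upclosed : ∀ q q' → q' ℚ.< q → U q' → U q
    below1   : U 1ℚ          -- α < 1
    nonneg   : ¬ U 0ℚ        -- 0 ≤ α

-- b_T(G) > α  ⇔  some rational point of the simplex has m_T p_G(x) > α
BlowupAbove : {r n : ℕ} {Th : GDH r} → TGraph Th n → (ℚ → Set) → Set
BlowupAbove G U = Σ _ λ x → InSimplex x × U (blowupAt G x)

-- b_T(G) ≤ α  ⇔  no rational point of the simplex has m_T p_G(x) > α
BlowupAtMost : {r n : ℕ} {Th : GDH r} → TGraph Th n → (ℚ → Set) → Set
BlowupAtMost G U = ∀ x → InSimplex x → ¬ U (blowupAt G x)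

record SubTGraph {r n : ℕ} {Th : GDH r} (G : TGraph Th n) : Set where
  field
    k    : ℕ
    emb  : Fin k → Fin n
    emb-inj : Injective _≡_ _≡_ emb
    H    : TGraph Th k
    H⊆G  : ∀ t → T (E H t) → T (E G (Vec.map emb t))
open SubTGraph public

DemonstratedNonjump : {r : ℕ} → GDH r → (ℚ → Set) → Set
DemonstratedNonjump Th U =
  UpperCut01 U ×
  Σ (ℕ → Σ ℕ (TGraph Th)) λ Gs →
    (∀ i → BlowupAbove (proj₂ (Gs i)) U) ×
    (∀ l → Σ ℕ λ n₀ → ∀ i → n₀ ≤ i →
       ∀ (S : SubTGraph (proj₂ (Gs i))) → k S ≤ l → BlowupAtMost (H S) U)

-- upper cut of (a/b)·α for b > 0:  (a/b)α < q  ⇔  ∃ s > α, a·s ≤ b·q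
scaleCut : ℕ → ℕ → (ℚ → Set) → (ℚ → Set)
scaleCut a b U q = Σ ℚ λ s → U s × ((+ a ℚ./ 1) ℚ.* s ℚ.≤ (+ b ℚ./ 1) ℚ.* q)

module Submission where

-- Write m = m_T and m′ = m_T′. An edge of a T-graph is the J_T-orbit of an injective r-tuple; it has
-- m elements and splits into m/m′ orbits of J_T′ with m′ elements each. Ordering all tuples by their
-- position in a fixed enumeration, keep in every J_T-orbit the k J_T′-orbits whose least elements
-- come first. This turns a T-graph G into a T′-graph G′ with exactly k m′/m times as many edge tuples
-- on every r-set, so m_T′ p_G′ = (k m′/m) m_T p_G at every point of the simplex. A sub-T′-graph of G′
-- lies inside the graph built in the same way from the sub-T-graph of G induced on its vertices, so
-- its blowup density is at most k m′/m times that of a sub-T-graph of G of the same size.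

open import Defs
open import Data.Nat as ℕ using (ℕ; zero; suc; _+_; _*_; _∸_; _⊓_; _≤_; _<_; _<ᵇ_; z≤n; s≤s; NonZero; >-nonZero)
open import Data.Nat.Properties
  using ( +-identityʳ; *-identityˡ; *-identityʳ; *-zeroʳ; *-comm; *-assoc; *-distribˡ-+; +-suc; ⊓-zeroʳ
        ; ≤-reflexive; ≤-trans; ≤-antisym; <-≤-trans; ≮⇒≥; <⇒≱; +-mono-≤; *-mono-≤; *-cancelʳ-≤; m≤n⇒m⊓n≡m
        ; m≤m+n; m≤n+m; n<1+n; m+[n∸m]≡n; 0≢1+n; suc-injective; <ᵇ⇒<; <⇒<ᵇ; module ≤-Reasoning
        ; +-commutativeSemigroup; *-commutativeSemigroup )
open import Algebra.Properties.CommutativeSemigroup +-commutativeSemigroup using (interchange)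
open import Algebra.Properties.CommutativeSemigroup *-commutativeSemigroup using (x∙yz≈z∙yx)
open import Data.Bool using (Bool; true; false; T; not; _∧_; _∨_; T?; if_then_else_)
open import Data.Bool.Properties using (∧-zeroʳ; ∧-identityʳ; ∧-assoc; ∧-comm; T-∨; T-∧)
open import Data.Unit using (tt)
open import Data.Empty using (⊥-elim)
open import Data.Sum using (inj₁; inj₂)
open import Data.Product using (∃; ∃₂; _×_; _,_; proj₁; proj₂)
open import Data.Fin as Fin using (Fin; toℕ)
open import Data.Fin.Properties using (pigeonhole)
open import Data.List as List using (List; []; _∷_; allFin)
open import Data.List.Membership.Propositional using (_∈_)
open import Data.List.Membership.Propositional.Properties using (∈-concatMap⁺; ∈-map⁺; ∈-map⁻; ∈-allFin)
open import Data.List.Relation.Unary.All as All using (All; []; _∷_)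
import Data.List.Relation.Unary.All.Properties as All
open import Data.List.Relation.Unary.Any as Any using (here; there)
open import Data.List.Relation.Unary.Any.Properties using (lookup-index)
import Data.List.Relation.Unary.AllPairs as AllPairs
import Data.List.Relation.Unary.AllPairs.Properties as AllPairs
open import Data.List.Relation.Unary.Unique.Propositional using (Unique; []; _∷_)
import Data.List.Relation.Unary.Unique.Propositional.Properties as Unique
open import Data.List.Relation.Binary.Disjoint.Propositional using (Disjoint)
open import Data.Vec as Vec using (Vec; []; _∷_; lookup)
open import Data.Vec.Properties
  using (≡-dec; ∷-injectiveˡ; ∷-injectiveʳ; lookup∘tabulate; tabulate∘lookup; tabulate-cong; lookup-map)
import Data.Integer as ℤ
import Data.Integer.Properties as ℤ
open import Data.Rational as ℚ using (ℚ; 0ℚ; 1ℚ)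
open import Data.Rational.Literals using (fromℤ)
import Data.Rational.Properties as ℚ
open import Function using (_∘_)
open import Function.Bundles using (Equivalence)
open import Function.Definitions using (Injective)
open import Relation.Nullary using (¬_; yes; no; contradiction)
open import Relation.Nullary.Decidable using (⌊_⌋; toWitness; fromWitness)
open import Relation.Binary.Definitions using (DecidableEquality)
open import Relation.Binary.Structures using (IsEquivalence)
open import Relation.Binary.PropositionalEquality hiding (J)

𝟙 : Bool → ℕ
𝟙 true  = 1
𝟙 false = 0

𝟙-true : ∀ {b} → T b → 𝟙 b ≡ 1
𝟙-true {true} _ = refl

𝟙-false : ∀ {b} → ¬ T b → 𝟙 b ≡ 0
𝟙-false {true}  ¬b = contradiction tt ¬b
𝟙-false {false} _  = refl

𝟙-∧ : ∀ a b → 𝟙 (a ∧ b) ≡ 𝟙 a * 𝟙 b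
𝟙-∧ true  b = sym (+-identityʳ (𝟙 b))
𝟙-∧ false b = refl

T-⇔⇒≡ : ∀ {a b} → (T a → T b) → (T b → T a) → a ≡ b
T-⇔⇒≡ {true}  {true}  _ _ = refl
T-⇔⇒≡ {true}  {false} f _ = ⊥-elim (f tt)
T-⇔⇒≡ {false} {true}  _ g = ⊥-elim (g tt)
T-⇔⇒≡ {false} {false} _ _ = refl

T-not⁺ : ∀ {b} → ¬ T b → T (not b)
T-not⁺ {true}  ¬b = ¬b tt
T-not⁺ {false} _  = tt

T-not⁻ : ∀ {b} → T (not b) → ¬ T b
T-not⁻ {true} ()

𝟙-mono : ∀ a b → (T a → T b) → 𝟙 a ≤ 𝟙 b
𝟙-mono true  b a⇒b = ≤-reflexive (sym (𝟙-true (a⇒b tt)))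
𝟙-mono false b _   = z≤n

𝟙*-cong : ∀ b {m n} → (T b → m ≡ n) → 𝟙 b * m ≡ 𝟙 b * n
𝟙*-cong true  m≡n = cong (_+ 0) (m≡n tt)
𝟙*-cong false _   = refl

𝟙-∧-∧ : ∀ a b c → 𝟙 ((a ∧ b) ∧ c) ≡ 𝟙 (a ∧ c) * 𝟙 b
𝟙-∧-∧ false b c = refl
𝟙-∧-∧ true  b c = trans (𝟙-∧ b c) (*-comm (𝟙 b) (𝟙 c))

𝟙-regroup : ∀ a b c c′ n → (T b → c ≡ c′) → 𝟙 (a ∧ b) * (𝟙 c * n) ≡ 𝟙 (a ∧ c′) * (𝟙 b * n)
𝟙-regroup false b     c c′ n _    = refl
𝟙-regroup true  false c c′ n _    = sym (*-zeroʳ (𝟙 c′))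
𝟙-regroup true  true  c c′ n c≡c′ rewrite c≡c′ tt =
  trans (*-identityˡ (𝟙 c′ * n)) (cong (𝟙 c′ *_) (sym (*-identityˡ n)))

module _ {A : Set} where

  ∑ : List A → (A → ℕ) → ℕ
  ∑ []       f = 0
  ∑ (x ∷ xs) f = f x + ∑ xs f

  syntax ∑ xs (λ x → e) = ∑[ x ∈ xs ] e

  ∑-cong : ∀ xs {f g : A → ℕ} → (∀ x → f x ≡ g x) → ∑ xs f ≡ ∑ xs g
  ∑-cong []       f≗g = refl
  ∑-cong (x ∷ xs) f≗g = cong₂ _+_ (f≗g x) (∑-cong xs f≗g)

  ∑-cong-All : ∀ {xs} {f g : A → ℕ} → All (λ x → f x ≡ g x) xs → ∑ xs f ≡ ∑ xs g
  ∑-cong-All []         = refl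
  ∑-cong-All (fx≡gx ∷ eqs) = cong₂ _+_ fx≡gx (∑-cong-All eqs)

  ∑-zero : ∀ xs {f : A → ℕ} → (∀ x → f x ≡ 0) → ∑ xs f ≡ 0
  ∑-zero []       f≗0 = refl
  ∑-zero (x ∷ xs) f≗0 = cong₂ _+_ (f≗0 x) (∑-zero xs f≗0)

  ∑-+ : ∀ xs (f g : A → ℕ) → ∑[ x ∈ xs ] (f x + g x) ≡ ∑ xs f + ∑ xs g
  ∑-+ []       f g = refl
  ∑-+ (x ∷ xs) f g = trans (cong (f x + g x +_) (∑-+ xs f g)) (interchange (f x) (g x) (∑ xs f) (∑ xs g))

  ∑-*ˡ : ∀ xs c (f : A → ℕ) → ∑[ x ∈ xs ] (c * f x) ≡ c * ∑ xs f
  ∑-*ˡ []       c f = sym (*-zeroʳ c)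
  ∑-*ˡ (x ∷ xs) c f = trans (cong (c * f x +_) (∑-*ˡ xs c f)) (sym (*-distribˡ-+ c (f x) (∑ xs f)))

  ∑-*ʳ : ∀ xs c (f : A → ℕ) → ∑[ x ∈ xs ] (f x * c) ≡ ∑ xs f * c
  ∑-*ʳ xs c f = begin
    ∑[ x ∈ xs ] (f x * c) ≡⟨ ∑-cong xs (λ x → *-comm (f x) c) ⟩
    ∑[ x ∈ xs ] (c * f x) ≡⟨ ∑-*ˡ xs c f ⟩
    c * ∑ xs f            ≡⟨ *-comm c (∑ xs f) ⟩
    ∑ xs f * c            ∎
    where open ≡-Reasoning

  ∑-mono-≤ : ∀ xs {f g : A → ℕ} → (∀ x → f x ≤ g x) → ∑ xs f ≤ ∑ xs g
  ∑-mono-≤ []       f≤g = z≤n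
  ∑-mono-≤ (x ∷ xs) f≤g = +-mono-≤ (f≤g x) (∑-mono-≤ xs f≤g)

  ∑-term : ∀ {x xs} → x ∈ xs → (f : A → ℕ) → f x ≤ ∑ xs f
  ∑-term (here refl)  f = m≤m+n _ _
  ∑-term {xs = y ∷ _} (there x∈xs) f = ≤-trans (∑-term x∈xs f) (m≤n+m _ (f y))

  count≡∑ : ∀ (p : A → Bool) xs → count p xs ≡ ∑[ x ∈ xs ] 𝟙 (p x)
  count≡∑ p []       = refl
  count≡∑ p (x ∷ xs) with p x
  ... | true  = cong suc (count≡∑ p xs)
  ... | false = count≡∑ p xs

  anyL-intro : ∀ {p : A → Bool} {x xs} → x ∈ xs → T (p x) → T (anyL p xs)
  anyL-intro         (here refl)            px = Equivalence.from T-∨ (inj₁ px)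
  anyL-intro {p = p} (there {x = y} x∈xs) px = Equivalence.from (T-∨ {p y}) (inj₂ (anyL-intro x∈xs px))

  anyL-elim : ∀ {p : A → Bool} xs → T (anyL p xs) → ∃ λ x → T (p x)
  anyL-elim {p} (x ∷ xs) any with Equivalence.to (T-∨ {p x}) any
  ... | inj₁ px  = x , px
  ... | inj₂ any′ = anyL-elim xs any′

  anyL-cong : ∀ {p q : A → Bool} xs → (∀ x → p x ≡ q x) → anyL p xs ≡ anyL q xs
  anyL-cong []       p≗q = refl
  anyL-cong (x ∷ xs) p≗q = cong₂ _∨_ (p≗q x) (anyL-cong xs p≗q)

  not-anyL-intro : ∀ {p : A → Bool} xs → (∀ x → ¬ T (p x)) → T (not (anyL p xs))
  not-anyL-intro xs none = T-not⁺ λ any → let x , px = anyL-elim xs any in none x px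

  not-anyL-elim : ∀ {p : A → Bool} {x xs} → x ∈ xs → T (not (anyL p xs)) → ¬ T (p x)
  not-anyL-elim x∈xs none = T-not⁻ none ∘ anyL-intro x∈xs

∑-swap : ∀ {A B : Set} (xs : List A) (ys : List B) (f : A → B → ℕ) →
         ∑[ x ∈ xs ] ∑[ y ∈ ys ] f x y ≡ ∑[ y ∈ ys ] ∑[ x ∈ xs ] f x y
∑-swap []       ys f = sym (∑-zero ys (λ _ → refl))
∑-swap (x ∷ xs) ys f = trans (cong (∑ ys (f x) +_) (∑-swap xs ys f))
                             (sym (∑-+ ys (f x) (λ y → ∑[ x ∈ xs ] f x y)))

module _ {A : Set} where

  ∑-𝟙-unique : ∀ {p : A → Bool} {x xs} → Unique xs → x ∈ xs → T (p x) → (∀ y → T (p y) → y ≡ x) →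
               ∑[ y ∈ xs ] 𝟙 (p y) ≡ 1
  ∑-𝟙-unique {p} {x} {_ ∷ xs} (x∉ ∷ _) (here refl) px only =
    cong₂ _+_ (𝟙-true px) (trans (∑-cong-All (All.map (λ x≢y → 𝟙-false (λ py → x≢y (sym (only _ py)))) x∉))
                                 (∑-zero xs (λ _ → refl)))
  ∑-𝟙-unique {p} (y∉ ∷ u) (there x∈xs) px only =
    cong₂ _+_ (𝟙-false (λ py → All.lookup y∉ x∈xs (only _ py))) (∑-𝟙-unique u x∈xs px only)

  module _ (_≟_ : DecidableEquality A) where

    position : List A → A → ℕ
    position []       x = 0
    position (y ∷ ys) x with y ≟ x
    ... | yes _ = 0
    ... | no  _ = suc (position ys x)

    position-here : ∀ x xs → position (x ∷ xs) x ≡ 0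
    position-here x xs with x ≟ x
    ... | yes _   = refl
    ... | no  x≢x = contradiction refl x≢x

    position-there : ∀ {x y} xs → x ≢ y → position (x ∷ xs) y ≡ suc (position xs y)
    position-there {x} {y} xs x≢y with x ≟ y
    ... | yes x≡y = contradiction x≡y x≢y
    ... | no  _   = refl

    position-injective : ∀ {x y xs} → x ∈ xs → position xs x ≡ position xs y → x ≡ y
    position-injective {x} {y} {z ∷ xs} x∈ eq with z ≟ x | z ≟ y
    ... | yes z≡x | yes z≡y = trans (sym z≡x) z≡y
    ... | yes _   | no  _   = contradiction eq 0≢1+n
    ... | no  _   | yes _   = contradiction (sym eq) 0≢1+n
    ... | no  z≢x | no  _   with x∈
    ...   | here x≡z    = contradiction (sym x≡z) z≢x
    ...   | there x∈xs  = position-injective x∈xs (suc-injective eq)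

    least : ∀ (p : A → Bool) {x} xs → x ∈ xs → T (p x) →
            ∃ λ m → T (p m) × (∀ {y} → y ∈ xs → T (p y) → position xs m ≤ position xs y)
    least p (z ∷ xs) x∈ px with T? (p z)
    ... | yes pz = z , pz , λ {y} _ _ → subst (_≤ position (z ∷ xs) y) (sym (position-here z xs)) z≤n
    ... | no ¬pz with x∈
    ...   | here refl  = contradiction px ¬pz
    ...   | there x∈xs =
      let m , pm , m≤ = least p xs x∈xs px in
      m , pm , λ where
        (here refl)  py → contradiction py ¬pz
        (there y∈xs) py → subst₂ _≤_ (sym (position-there xs (λ z≡m → ¬pz (subst (T ∘ p) (sym z≡m) pm))))
                                     (sym (position-there xs (λ z≡y → ¬pz (subst (T ∘ p) (sym z≡y) py))))
                                     (s≤s (m≤ y∈xs py))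

    rank : List A → (A → Bool) → A → ℕ
    rank xs S v = ∑[ w ∈ xs ] 𝟙 (S w ∧ (position xs w <ᵇ position xs v))

    rank-head : ∀ (S : A → Bool) x xs → rank (x ∷ xs) S x ≡ 0
    rank-head S x xs rewrite position-here x xs = ∑-zero (x ∷ xs) (λ w → cong 𝟙 (∧-zeroʳ (S w)))

    rank-there : ∀ (S : A → Bool) {x v xs} → All (x ≢_) xs → x ≢ v →
                 rank (x ∷ xs) S v ≡ 𝟙 (S x) + rank xs S v
    rank-there S {x} {v} {xs} x∉ x≢v rewrite position-here x xs | position-there xs x≢v =
      cong₂ _+_ (cong 𝟙 (∧-identityʳ (S x)))
                (∑-cong-All (All.map (λ {w} x≢w → cong (λ p → 𝟙 (S w ∧ (p <ᵇ suc (position xs v))))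
                                                       (position-there xs x≢w)) x∉))

    ∑-rank< : ∀ {xs} → Unique xs → (S : A → Bool) (k : ℕ) →
              ∑[ v ∈ xs ] 𝟙 (S v ∧ (rank xs S v <ᵇ k)) ≡ k ⊓ ∑[ v ∈ xs ] 𝟙 (S v)
    ∑-rank< {[]}     []        S k = sym (⊓-zeroʳ k)
    ∑-rank< {x ∷ xs} (x∉ ∷ u) S k = begin
      ∑[ v ∈ x ∷ xs ] 𝟙 (S v ∧ (rank (x ∷ xs) S v <ᵇ k))
        ≡⟨ cong₂ _+_ (cong (λ ρ → 𝟙 (S x ∧ (ρ <ᵇ k))) (rank-head S x xs))
                     (∑-cong-All (All.map (λ {v} x≢v → cong (λ ρ → 𝟙 (S v ∧ (ρ <ᵇ k))) (rank-there S x∉ x≢v))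
                                          x∉)) ⟩
      𝟙 (S x ∧ (0 <ᵇ k)) + ∑[ v ∈ xs ] 𝟙 (S v ∧ (𝟙 (S x) + rank xs S v <ᵇ k))
        ≡⟨ by-head (S x) k ⟩
      k ⊓ (𝟙 (S x) + ∑[ v ∈ xs ] 𝟙 (S v))
        ∎
      where
      open ≡-Reasoning
      by-head : ∀ b k → 𝟙 (b ∧ (0 <ᵇ k)) + ∑[ v ∈ xs ] 𝟙 (S v ∧ (𝟙 b + rank xs S v <ᵇ k))
                        ≡ k ⊓ (𝟙 b + ∑[ v ∈ xs ] 𝟙 (S v))
      by-head false k       = ∑-rank< u S k
      by-head true  zero    = ∑-zero xs (λ v → cong 𝟙 (∧-zeroʳ (S v)))
      by-head true  (suc k) = cong suc (∑-rank< u S k)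

record Enumeration (A : Set) : Set where
  field
    _≟_      : DecidableEquality A
    elements : List A
    unique   : Unique elements
    complete : ∀ x → x ∈ elements

module Enumerated {A : Set} (E : Enumeration A) where
  open Enumeration E public

  count-unique : ∀ (p : A → Bool) {x} → T (p x) → (∀ y → T (p y) → y ≡ x) →
                 ∑[ y ∈ elements ] 𝟙 (p y) ≡ 1
  count-unique p px only = ∑-𝟙-unique unique (complete _) px only

  ∑-δ : ∀ (f : A → ℕ) x → ∑[ y ∈ elements ] (𝟙 ⌊ y ≟ x ⌋ * f y) ≡ f x
  ∑-δ f x = begin
    ∑[ y ∈ elements ] (𝟙 ⌊ y ≟ x ⌋ * f y) ≡⟨ ∑-cong elements δ-sift ⟩
    ∑[ y ∈ elements ] (𝟙 ⌊ y ≟ x ⌋ * f x) ≡⟨ ∑-*ʳ elements (f x) (λ y → 𝟙 ⌊ y ≟ x ⌋) ⟩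
    ∑[ y ∈ elements ] 𝟙 ⌊ y ≟ x ⌋ * f x   ≡⟨ cong (_* f x) (count-unique (λ y → ⌊ y ≟ x ⌋) (fromWitness refl)
                                                                    (λ _ → toWitness)) ⟩
    1 * f x                               ≡⟨ *-identityˡ (f x) ⟩
    f x                                   ∎
    where
    open ≡-Reasoning
    δ-sift : ∀ y → 𝟙 ⌊ y ≟ x ⌋ * f y ≡ 𝟙 ⌊ y ≟ x ⌋ * f x
    δ-sift y with y ≟ x
    ... | yes refl = refl
    ... | no  _    = refl

  anyL-complete : ∀ {p : A → Bool} {x} → T (p x) → T (anyL p elements)
  anyL-complete = anyL-intro (complete _)

  𝟙-anyL : ∀ (p : A → Bool) → (∀ {x y} → T (p x) → T (p y) → x ≡ y) →
           𝟙 (anyL p elements) ≡ ∑[ x ∈ elements ] 𝟙 (p x)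
  𝟙-anyL p at-most-one with T? (anyL p elements)
  ... | yes any = let x , px = anyL-elim elements any in
                  trans (𝟙-true any) (sym (count-unique p px (λ y py → at-most-one py px)))
  ... | no ¬any = trans (𝟙-false ¬any) (sym (∑-zero elements (λ x → 𝟙-false (¬any ∘ anyL-complete))))

  pos : A → ℕ
  pos = position _≟_ elements

  pos-injective : ∀ {x y} → pos x ≡ pos y → x ≡ y
  pos-injective = position-injective _≟_ (complete _)

  minimum : ∀ (p : A → Bool) {x} → T (p x) → ∃ λ m → T (p m) × (∀ y → T (p y) → pos m ≤ pos y)
  minimum p px = let m , pm , m≤ = least _≟_ p elements (complete _) px in
                 m , pm , λ y → m≤ (complete y)

  ∑-rank<ᵇ : ∀ (S : A → Bool) k →
             ∑[ v ∈ elements ] 𝟙 (S v ∧ (rank _≟_ elements S v <ᵇ k)) ≡ k ⊓ ∑[ v ∈ elements ] 𝟙 (S v)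
  ∑-rank<ᵇ = ∑-rank< _≟_ unique

  repeats : (f : ℕ → A) → ∃₂ λ i j → i < j × f i ≡ f j
  repeats f =
    let i , j , i<j , same-index = pigeonhole (n<1+n _) (λ i → Any.index (complete (f (toℕ i)))) in
    toℕ i , toℕ j , i<j ,
    trans (lookup-index (complete (f (toℕ i))))
          (trans (cong (List.lookup elements) same-index) (sym (lookup-index (complete (f (toℕ j))))))

-- Classes of a decidable equivalence relation

module Classes {A : Set} (E : Enumeration A) (_~_ : A → A → Bool)
               (~-isEquivalence : IsEquivalence (λ x y → T (x ~ y))) where
  open Enumerated E
  open IsEquivalence ~-isEquivalence renaming (refl to ~-refl; sym to ~-sym; trans to ~-trans)

  ~-resp : ∀ {u u′} → T (u ~ u′) → ∀ v → (u ~ v) ≡ (u′ ~ v)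
  ~-resp u~u′ v = T-⇔⇒≡ (~-trans (~-sym u~u′)) (~-trans u~u′)

  isLeast : A → Bool
  isLeast w = not (anyL (λ u → w ~ u ∧ (pos u <ᵇ pos w)) elements)

  isLeast⇒≤ : ∀ {w u} → T (isLeast w) → T (w ~ u) → pos w ≤ pos u
  isLeast⇒≤ {w} {u} least w~u =
    ≮⇒≥ (λ u<w → not-anyL-elim (complete u) least (Equivalence.from T-∧ (w~u , <⇒<ᵇ u<w)))

  count-least : ∀ u → ∑[ w ∈ elements ] 𝟙 (isLeast w ∧ (w ~ u)) ≡ 1
  count-least u = count-unique (λ w → isLeast w ∧ (w ~ u)) (Equivalence.from T-∧ (m-least , m~u)) only
    where
    m-min = minimum (_~ u) (~-refl {u})
    m = proj₁ m-min
    m~u = proj₁ (proj₂ m-min)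
    m≤ = proj₂ (proj₂ m-min)

    m-least : T (isLeast m)
    m-least = not-anyL-intro elements λ v m~v∧v<m →
      let m~v , v<m = Equivalence.to T-∧ m~v∧v<m in
      <⇒≱ (<ᵇ⇒< _ _ v<m) (m≤ v (~-trans (~-sym m~v) m~u))

    only : ∀ w → T (isLeast w ∧ (w ~ u)) → w ≡ m
    only w least∧w~u =
      let w-least , w~u = Equivalence.to T-∧ least∧w~u in
      pos-injective (≤-antisym (isLeast⇒≤ w-least (~-trans w~u (~-sym m~u)))
                               (isLeast⇒≤ m-least (~-trans m~u (~-sym w~u))))

  classSize : A → ℕ
  classSize w = ∑[ u ∈ elements ] 𝟙 (w ~ u)

  classCount : (A → Bool) → ℕ
  classCount X = ∑[ w ∈ elements ] 𝟙 (isLeast w ∧ X w)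

  ∑-classes : ∀ (X : A → Bool) → (∀ {u v} → T (u ~ v) → T (X u) → T (X v)) → (f : A → ℕ) →
              ∑[ u ∈ elements ] (𝟙 (X u) * f u)
                ≡ ∑[ w ∈ elements ] (𝟙 (isLeast w ∧ X w) * ∑[ u ∈ elements ] (𝟙 (w ~ u) * f u))
  ∑-classes X X-closed f = begin
    ∑[ u ∈ elements ] (𝟙 (X u) * f u)
      ≡⟨ ∑-cong elements (λ u → sym (trans (cong (_* (𝟙 (X u) * f u)) (count-least u)) (*-identityˡ _))) ⟩
    ∑[ u ∈ elements ] (∑[ w ∈ elements ] 𝟙 (isLeast w ∧ (w ~ u)) * (𝟙 (X u) * f u))
      ≡⟨ ∑-cong elements (λ u → sym (∑-*ʳ elements _ _)) ⟩
    ∑[ u ∈ elements ] ∑[ w ∈ elements ] (𝟙 (isLeast w ∧ (w ~ u)) * (𝟙 (X u) * f u))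
      ≡⟨ ∑-swap elements elements _ ⟩
    ∑[ w ∈ elements ] ∑[ u ∈ elements ] (𝟙 (isLeast w ∧ (w ~ u)) * (𝟙 (X u) * f u))
      ≡⟨ ∑-cong elements (λ w → ∑-cong elements (λ u →
           𝟙-regroup (isLeast w) (w ~ u) (X u) (X w) (f u)
                     (λ w~u → T-⇔⇒≡ (X-closed (~-sym w~u)) (X-closed w~u)))) ⟩
    ∑[ w ∈ elements ] ∑[ u ∈ elements ] (𝟙 (isLeast w ∧ X w) * (𝟙 (w ~ u) * f u))
      ≡⟨ ∑-cong elements (λ w → ∑-*ˡ elements (𝟙 (isLeast w ∧ X w)) (λ u → 𝟙 (w ~ u) * f u)) ⟩
    ∑[ w ∈ elements ] (𝟙 (isLeast w ∧ X w) * ∑[ u ∈ elements ] (𝟙 (w ~ u) * f u))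
      ∎
    where open ≡-Reasoning

  ∑-class-invariant : ∀ (f : A → ℕ) → (∀ {u v} → T (u ~ v) → f u ≡ f v) → ∀ w →
                      ∑[ u ∈ elements ] (𝟙 (w ~ u) * f u) ≡ classSize w * f w
  ∑-class-invariant f f-inv w =
    trans (∑-cong elements (λ u → 𝟙*-cong (w ~ u) (λ w~u → f-inv (~-sym w~u)))) (∑-*ʳ elements (f w) _)

  ∑-classes-const : ∀ (X : A → Bool) → (∀ {u v} → T (u ~ v) → T (X u) → T (X v)) → (f : A → ℕ) (c : ℕ) →
                    (∀ w → T (X w) → ∑[ u ∈ elements ] (𝟙 (w ~ u) * f u) ≡ c) →
                    ∑[ u ∈ elements ] (𝟙 (X u) * f u) ≡ classCount X * c
  ∑-classes-const X X-closed f c const =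
    trans (∑-classes X X-closed f)
          (trans (∑-cong elements (λ w → 𝟙*-cong (isLeast w ∧ X w) (const w ∘ proj₂ ∘ Equivalence.to T-∧)))
                 (∑-*ʳ elements c _))

-- In every ≈-class, choose the first k of its ~-classes, ordered by their least elements.
module Choice {A : Set} (E : Enumeration A) (_≈_ _~_ : A → A → Bool)
              (≈-isEquivalence : IsEquivalence (λ x y → T (x ≈ y)))
              (~-isEquivalence : IsEquivalence (λ x y → T (x ~ y)))
              (~⇒≈ : ∀ {u v} → T (u ~ v) → T (u ≈ v)) (k : ℕ) where
  open Enumerated E
  open Classes E _~_ ~-isEquivalence
  private module ≈ = Classes E _≈_ ≈-isEquivalence
  open IsEquivalence ≈-isEquivalence using () renaming (sym to ≈-sym; trans to ≈-trans)
  open IsEquivalence ~-isEquivalence using () renaming (refl to ~-refl)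

  precedesClass : A → A → Bool
  precedesClass w u = not (anyL (λ v → u ~ v ∧ not (pos w <ᵇ pos v)) elements)

  classesBefore : A → ℕ
  classesBefore u = ∑[ w ∈ elements ] 𝟙 (u ≈ w ∧ (isLeast w ∧ precedesClass w u))

  chosen : A → Bool
  chosen u = classesBefore u <ᵇ k

  chosen-resp : ∀ {u u′} → T (u ~ u′) → chosen u ≡ chosen u′
  chosen-resp {u} {u′} u~u′ = cong (_<ᵇ k) (∑-cong elements λ w →
    cong₂ (λ a b → 𝟙 (a ∧ (isLeast w ∧ not b)))
          (≈.~-resp (~⇒≈ u~u′) w)
          (anyL-cong elements (λ v → cong (_∧ not (pos w <ᵇ pos v)) (~-resp u~u′ v))))

  precedesClass-least : ∀ {w w′} → T (isLeast w) → precedesClass w′ w ≡ (pos w′ <ᵇ pos w)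
  precedesClass-least {w} {w′} w-least = T-⇔⇒≡ before-w before-class
    where
    before-w : T (precedesClass w′ w) → T (pos w′ <ᵇ pos w)
    before-w precedes with T? (pos w′ <ᵇ pos w)
    ... | yes w′<w = w′<w
    ... | no  w′≮w = contradiction (Equivalence.from T-∧ (~-refl , T-not⁺ w′≮w))
                                   (not-anyL-elim (complete w) precedes)
    before-class : T (pos w′ <ᵇ pos w) → T (precedesClass w′ w)
    before-class w′<w = not-anyL-intro elements λ v w~v∧v≤w′ →
      let w~v , v≤w′ = Equivalence.to T-∧ w~v∧v≤w′ in
      T-not⁻ v≤w′ (<⇒<ᵇ (<-≤-trans (<ᵇ⇒< _ _ w′<w) (isLeast⇒≤ w-least w~v)))

  module _ (t : A) where

    leastIn : A → Bool
    leastIn w = isLeast w ∧ (t ≈ w)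

    classesBefore≡rank : ∀ {w} → T (leastIn w) → classesBefore w ≡ rank _≟_ elements leastIn w
    classesBefore≡rank {w} least∧t≈w = ∑-cong elements λ w′ → cong 𝟙 (begin
      w ≈ w′ ∧ (isLeast w′ ∧ precedesClass w′ w) ≡⟨ cong₂ (λ a b → a ∧ (isLeast w′ ∧ b))
                                                          (≈.~-resp (≈-sym t≈w) w′) (precedesClass-least w-least) ⟩
      t ≈ w′ ∧ (isLeast w′ ∧ (pos w′ <ᵇ pos w))   ≡⟨ sym (∧-assoc (t ≈ w′) (isLeast w′) _) ⟩
      (t ≈ w′ ∧ isLeast w′) ∧ (pos w′ <ᵇ pos w)   ≡⟨ cong (_∧ _) (∧-comm (t ≈ w′) (isLeast w′)) ⟩
      leastIn w′ ∧ (pos w′ <ᵇ pos w)              ∎)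
      where
      open ≡-Reasoning
      w-least = proj₁ (Equivalence.to T-∧ least∧t≈w)
      t≈w = proj₂ (Equivalence.to T-∧ least∧t≈w)

    module _ (s : ℕ) (classSize≡s : ∀ w → T (t ≈ w) → classSize w ≡ s) where

      ∑-coarseClass : ∀ (g : A → ℕ) → (∀ {u v} → T (u ~ v) → g u ≡ g v) →
                      ∑[ u ∈ elements ] (𝟙 (t ≈ u) * g u) ≡ ∑[ w ∈ elements ] (𝟙 (leastIn w) * g w) * s
      ∑-coarseClass g g-inv = begin
        ∑[ u ∈ elements ] (𝟙 (t ≈ u) * g u)
          ≡⟨ ∑-classes (t ≈_) (λ u~v t≈u → ≈-trans t≈u (~⇒≈ u~v)) g ⟩
        ∑[ w ∈ elements ] (𝟙 (leastIn w) * ∑[ u ∈ elements ] (𝟙 (w ~ u) * g u))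
          ≡⟨ ∑-cong elements (λ w → cong (𝟙 (leastIn w) *_) (∑-class-invariant g g-inv w)) ⟩
        ∑[ w ∈ elements ] (𝟙 (leastIn w) * (classSize w * g w))
          ≡⟨ ∑-cong elements (λ w → 𝟙*-cong (leastIn w) λ least∧t≈w →
               trans (cong (_* g w) (classSize≡s w (proj₂ (Equivalence.to T-∧ least∧t≈w)))) (*-comm s (g w))) ⟩
        ∑[ w ∈ elements ] (𝟙 (leastIn w) * (g w * s))
          ≡⟨ ∑-cong elements (λ w → sym (*-assoc (𝟙 (leastIn w)) (g w) s)) ⟩
        ∑[ w ∈ elements ] (𝟙 (leastIn w) * g w * s)
          ≡⟨ ∑-*ʳ elements s _ ⟩
        ∑[ w ∈ elements ] (𝟙 (leastIn w) * g w) * s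
          ∎
        where open ≡-Reasoning

      count-chosen : .{{_ : NonZero s}} → k * s ≤ ≈.classSize t →
                     ∑[ u ∈ elements ] (𝟙 (t ≈ u) * 𝟙 (chosen u)) ≡ k * s
      count-chosen ks≤ = begin
        ∑[ u ∈ elements ] (𝟙 (t ≈ u) * 𝟙 (chosen u))
          ≡⟨ ∑-coarseClass (𝟙 ∘ chosen) (cong 𝟙 ∘ chosen-resp) ⟩
        ∑[ w ∈ elements ] (𝟙 (leastIn w) * 𝟙 (chosen w)) * s
          ≡⟨ cong (_* s) (∑-cong elements λ w →
               trans (𝟙*-cong (leastIn w) (cong (λ c → 𝟙 (c <ᵇ k)) ∘ classesBefore≡rank))
                     (sym (𝟙-∧ (leastIn w) _))) ⟩
        ∑[ w ∈ elements ] 𝟙 (leastIn w ∧ (rank _≟_ elements leastIn w <ᵇ k)) * s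
          ≡⟨ cong (_* s) (∑-rank<ᵇ leastIn k) ⟩
        (k ⊓ #least) * s
          ≡⟨ cong (_* s) (m≤n⇒m⊓n≡m (*-cancelʳ-≤ k #least s (≤-trans ks≤ (≤-reflexive classSize≡)))) ⟩
        k * s
          ∎
        where
        open ≡-Reasoning
        #least = ∑[ w ∈ elements ] 𝟙 (leastIn w)
        classSize≡ : ≈.classSize t ≡ #least * s
        classSize≡ = begin
          ∑[ u ∈ elements ] 𝟙 (t ≈ u)                ≡⟨ ∑-cong elements (λ u → sym (*-identityʳ _)) ⟩
          ∑[ u ∈ elements ] (𝟙 (t ≈ u) * 1)          ≡⟨ ∑-coarseClass (λ _ → 1) (λ _ → refl) ⟩
          ∑[ w ∈ elements ] (𝟙 (leastIn w) * 1) * s ≡⟨ cong (_* s) (∑-cong elements (λ w → *-identityʳ _)) ⟩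
          #least * s                                 ∎

allTuples-complete : ∀ n r (t : Vec (Fin n) r) → t ∈ allTuples n r
allTuples-complete n zero    []      = here refl
allTuples-complete n (suc r) (i ∷ t) =
  ∈-concatMap⁺ (λ j → List.map (j ∷_) (allTuples n r))
               (Any.map (λ { refl → ∈-map⁺ (i ∷_) (allTuples-complete n r t) }) (∈-allFin i))

allTuples-unique : ∀ n r → Unique (allTuples n r)
allTuples-unique n zero    = [] ∷ []
allTuples-unique n (suc r) =
  Unique.concat⁺ (All.map⁺ (All.universal (λ i → Unique.map⁺ ∷-injectiveʳ (allTuples-unique n r)) (allFin n)))
                 (AllPairs.map⁺ (AllPairs.map different-heads (Unique.allFin⁺ n)))
  where
  different-heads : ∀ {i j} → i ≢ j →
                    Disjoint (List.map (i ∷_) (allTuples n r)) (List.map (j ∷_) (allTuples n r))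
  different-heads i≢j (t∈i∷ , t∈j∷) =
    let _ , _ , t≡i∷ = ∈-map⁻ _ t∈i∷ ; _ , _ , t≡j∷ = ∈-map⁻ _ t∈j∷ in
    i≢j (∷-injectiveˡ (trans (sym t≡i∷) t≡j∷))

tuples : ∀ n r → Enumeration (Vec (Fin n) r)
tuples n r = record
  { _≟_      = ≡-dec Fin._≟_
  ; elements = allTuples n r
  ; unique   = allTuples-unique n r
  ; complete = allTuples-complete n r
  }

perms : ∀ r → Enumeration (Perm r)
perms r = tuples r r

lookup-ext : ∀ {A : Set} {m} {u v : Vec A m} → (∀ i → lookup u i ≡ lookup v i) → u ≡ v
lookup-ext {u = u} {v} eq = trans (sym (tabulate∘lookup u)) (trans (tabulate-cong eq) (tabulate∘lookup v))

module _ {r : ℕ} where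

  lookup-∘ₚ : ∀ (σ τ : Perm r) i → lookup (σ ∘ₚ τ) i ≡ lookup σ (lookup τ i)
  lookup-∘ₚ σ τ = lookup∘tabulate _

  lookup-idPerm : ∀ i → lookup (idPerm r) i ≡ i
  lookup-idPerm = lookup∘tabulate _

  module _ {n : ℕ} where

    lookup-act : ∀ (t : Vec (Fin n) r) σ i → lookup (act t σ) i ≡ lookup t (lookup σ i)
    lookup-act t σ = lookup∘tabulate _

    act-idPerm : ∀ (t : Vec (Fin n) r) → act t (idPerm r) ≡ t
    act-idPerm t = lookup-ext λ i → trans (lookup-act t (idPerm r) i) (cong (lookup t) (lookup-idPerm i))

    act-∘ₚ : ∀ (t : Vec (Fin n) r) σ τ → act t (σ ∘ₚ τ) ≡ act (act t σ) τ
    act-∘ₚ t σ τ = lookup-ext λ i → begin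
      lookup (act t (σ ∘ₚ τ)) i        ≡⟨ lookup-act t (σ ∘ₚ τ) i ⟩
      lookup t (lookup (σ ∘ₚ τ) i)     ≡⟨ cong (lookup t) (lookup-∘ₚ σ τ i) ⟩
      lookup t (lookup σ (lookup τ i)) ≡⟨ lookup-act t σ (lookup τ i) ⟨
      lookup (act t σ) (lookup τ i)    ≡⟨ lookup-act (act t σ) τ i ⟨
      lookup (act (act t σ) τ) i       ∎
      where open ≡-Reasoning

    act-act-rightInverse : ∀ (t : Vec (Fin n) r) {σ ρ} → (∀ i → lookup σ (lookup ρ i) ≡ i) → act (act t σ) ρ ≡ t
    act-act-rightInverse t {σ} {ρ} σρ≗id = lookup-ext λ i → begin
      lookup (act (act t σ) ρ) i       ≡⟨ lookup-act (act t σ) ρ i ⟩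
      lookup (act t σ) (lookup ρ i)    ≡⟨ lookup-act t σ (lookup ρ i) ⟩
      lookup t (lookup σ (lookup ρ i)) ≡⟨ cong (lookup t) (σρ≗id i) ⟩
      lookup t i                       ∎
      where open ≡-Reasoning

    act-injective : ∀ (t : Vec (Fin n) r) σ → Injective _≡_ _≡_ (lookup t) → IsPerm σ →
                    Injective _≡_ _≡_ (lookup (act t σ))
    act-injective t σ t-inj σ-inj {i} {j} eq =
      σ-inj (t-inj (trans (sym (lookup-act t σ i)) (trans eq (lookup-act t σ j))))

    act-cancelˡ : ∀ (t : Vec (Fin n) r) {σ σ′} → Injective _≡_ _≡_ (lookup t) →
                  act t σ ≡ act t σ′ → σ ≡ σ′
    act-cancelˡ t {σ} {σ′} t-inj eq = lookup-ext λ i →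
      t-inj (trans (sym (lookup-act t σ i)) (trans (cong (λ u → lookup u i) eq) (lookup-act t σ′ i)))

  act-map : ∀ {m n} (f : Fin m → Fin n) (t : Vec (Fin m) r) σ → Vec.map f (act t σ) ≡ act (Vec.map f t) σ
  act-map f t σ = lookup-ext λ i → begin
    lookup (Vec.map f (act t σ)) i    ≡⟨ lookup-map i f (act t σ) ⟩
    f (lookup (act t σ) i)            ≡⟨ cong f (lookup-act t σ i) ⟩
    f (lookup t (lookup σ i))         ≡⟨ lookup-map (lookup σ i) f t ⟨
    lookup (Vec.map f t) (lookup σ i) ≡⟨ lookup-act (Vec.map f t) σ i ⟨
    lookup (act (Vec.map f t) σ) i    ∎
    where open ≡-Reasoning

  pow : Perm r → ℕ → Perm r
  pow σ zero    = idPerm r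
  pow σ (suc i) = σ ∘ₚ pow σ i

  lookup-pow-+ : ∀ σ i j x → lookup (pow σ (i + j)) x ≡ lookup (pow σ i) (lookup (pow σ j) x)
  lookup-pow-+ σ zero    j x = sym (lookup-idPerm _)
  lookup-pow-+ σ (suc i) j x = begin
    lookup (σ ∘ₚ pow σ (i + j)) x                    ≡⟨ lookup-∘ₚ σ (pow σ (i + j)) x ⟩
    lookup σ (lookup (pow σ (i + j)) x)              ≡⟨ cong (lookup σ) (lookup-pow-+ σ i j x) ⟩
    lookup σ (lookup (pow σ i) (lookup (pow σ j) x)) ≡⟨ lookup-∘ₚ σ (pow σ i) _ ⟨
    lookup (σ ∘ₚ pow σ i) (lookup (pow σ j) x)       ∎
    where open ≡-Reasoning

  pow-isPerm : ∀ {σ} → IsPerm σ → ∀ i → IsPerm (pow σ i)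
  pow-isPerm σ-inj zero    {x} {y} eq = trans (sym (lookup-idPerm x)) (trans eq (lookup-idPerm y))
  pow-isPerm {σ} σ-inj (suc i) {x} {y} eq =
    pow-isPerm σ-inj i (σ-inj (trans (sym (lookup-∘ₚ σ (pow σ i) x)) (trans eq (lookup-∘ₚ σ (pow σ i) y))))

  module _ (Th : GDH r) where

    mT-pos : 0 < mT Th
    mT-pos = begin-strict
      0                                 <⟨ s≤s z≤n ⟩
      1                                 ≡⟨ 𝟙-true (J-id Th) ⟨
      𝟙 (J Th (idPerm r))               ≤⟨ ∑-term (Enumeration.complete (perms r) (idPerm r)) (𝟙 ∘ J Th) ⟩
      ∑[ σ ∈ allTuples r r ] 𝟙 (J Th σ) ≡⟨ count≡∑ (J Th) (allTuples r r) ⟨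
      mT Th                             ∎
      where open ≤-Reasoning

    J-pow : ∀ {σ} → T (J Th σ) → ∀ i → T (J Th (pow σ i))
    J-pow Jσ zero    = J-id Th
    J-pow Jσ (suc i) = J-comp Th _ _ Jσ (J-pow Jσ i)

    -- J is only assumed closed under composition; inverses exist because some power of σ repeats.
    J-rightInverse : ∀ {σ} → T (J Th σ) → ∃ λ ρ → T (J Th ρ) × (∀ i → lookup σ (lookup ρ i) ≡ i)
    J-rightInverse {σ} Jσ = pow σ d , J-pow Jσ d , σ∘σᵈ≗id
      where
      repetition = Enumerated.repeats (perms r) (pow σ)
      a = proj₁ repetition
      b = proj₁ (proj₂ repetition)
      a<b = proj₁ (proj₂ (proj₂ repetition))
      σᵃ≡σᵇ = proj₂ (proj₂ (proj₂ repetition))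
      d = b ∸ suc a
      σ∘σᵈ≗id : ∀ i → lookup σ (lookup (pow σ d) i) ≡ i
      σ∘σᵈ≗id i = trans (sym (lookup-∘ₚ σ (pow σ d) i)) (pow-isPerm (J-perm Th σ Jσ) a (begin
        lookup (pow σ a) (lookup (pow σ (suc d)) i) ≡⟨ lookup-pow-+ σ a (suc d) i ⟨
        lookup (pow σ (a + suc d)) i                 ≡⟨ cong (λ e → lookup (pow σ e) i)
                                                             (trans (+-suc a d) (m+[n∸m]≡n a<b)) ⟩
        lookup (pow σ b) i                           ≡⟨ cong (λ π → lookup π i) σᵃ≡σᵇ ⟨
        lookup (pow σ a) i                           ∎))
        where open ≡-Reasoning

-- Orbits

module _ {r : ℕ} (Th : GDH r) {n : ℕ} where
  private
    module Perms = Enumerated (perms r)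
    module Tuples = Enumerated (tuples n r)

  inOrbit : Vec (Fin n) r → Vec (Fin n) r → Bool
  inOrbit t u = anyL (λ σ → J Th σ ∧ (u ==ᵥ act t σ)) (allTuples r r)

  inOrbit-intro : ∀ t {σ} → T (J Th σ) → T (inOrbit t (act t σ))
  inOrbit-intro t Jσ = Perms.anyL-complete (Equivalence.from T-∧ (Jσ , fromWitness refl))

  inOrbit-elim : ∀ {t u} → T (inOrbit t u) → ∃ λ σ → T (J Th σ) × u ≡ act t σ
  inOrbit-elim t~u =
    let σ , Jσ∧u≡tσ = anyL-elim (allTuples r r) t~u ; Jσ , u≡tσ = Equivalence.to T-∧ Jσ∧u≡tσ in
    σ , Jσ , toWitness u≡tσ

  inOrbit-refl : ∀ t → T (inOrbit t t)
  inOrbit-refl t = subst (T ∘ inOrbit t) (act-idPerm t) (inOrbit-intro t (J-id Th))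

  inOrbit-sym : ∀ t u → T (inOrbit t u) → T (inOrbit u t)
  inOrbit-sym t u t~u =
    let σ , Jσ , u≡tσ = inOrbit-elim {t} {u} t~u ; ρ , Jρ , σρ≗id = J-rightInverse Th Jσ in
    subst (T ∘ inOrbit u) (trans (cong (λ v → act v ρ) u≡tσ) (act-act-rightInverse t {σ} {ρ} σρ≗id))
          (inOrbit-intro u Jρ)

  inOrbit-trans : ∀ t u w → T (inOrbit t u) → T (inOrbit u w) → T (inOrbit t w)
  inOrbit-trans t u w t~u u~w =
    let σ , Jσ , u≡tσ = inOrbit-elim {t} {u} t~u ; τ , Jτ , w≡uτ = inOrbit-elim {u} {w} u~w in
    subst (T ∘ inOrbit t) (trans (act-∘ₚ t σ τ) (sym (trans w≡uτ (cong (λ v → act v τ) u≡tσ))))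
          (inOrbit-intro t (J-comp Th σ τ Jσ Jτ))

  inOrbit-isEquivalence : IsEquivalence (λ t u → T (inOrbit t u))
  inOrbit-isEquivalence = record
    { refl  = λ {t} → inOrbit-refl t
    ; sym   = λ {t} {u} → inOrbit-sym t u
    ; trans = λ {t} {u} {w} → inOrbit-trans t u w
    }

  inOrbit-injective : ∀ t {u} → Injective _≡_ _≡_ (lookup t) → T (inOrbit t u) → Injective _≡_ _≡_ (lookup u)
  inOrbit-injective t {u} t-inj t~u =
    let σ , Jσ , u≡tσ = inOrbit-elim {t} {u} t~u in
    subst (λ u → Injective _≡_ _≡_ (lookup u)) (sym u≡tσ) (act-injective t σ t-inj (J-perm Th σ Jσ))

  ∑-orbit : ∀ t → Injective _≡_ _≡_ (lookup t) → (f : Vec (Fin n) r → ℕ) →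
            ∑[ u ∈ allTuples n r ] (𝟙 (inOrbit t u) * f u) ≡ ∑[ σ ∈ allTuples r r ] (𝟙 (J Th σ) * f (act t σ))
  ∑-orbit t t-inj f = begin
    ∑[ u ∈ allTuples n r ] (𝟙 (inOrbit t u) * f u)
      ≡⟨ ∑-cong (allTuples n r) (λ u → cong (_* f u) (Perms.𝟙-anyL _ (at-most-one u))) ⟩
    ∑[ u ∈ allTuples n r ] (∑[ σ ∈ allTuples r r ] 𝟙 (J Th σ ∧ (u ==ᵥ act t σ)) * f u)
      ≡⟨ ∑-cong (allTuples n r) (λ u → sym (∑-*ʳ (allTuples r r) (f u) _)) ⟩
    ∑[ u ∈ allTuples n r ] ∑[ σ ∈ allTuples r r ] (𝟙 (J Th σ ∧ (u ==ᵥ act t σ)) * f u)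
      ≡⟨ ∑-swap (allTuples n r) (allTuples r r) _ ⟩
    ∑[ σ ∈ allTuples r r ] ∑[ u ∈ allTuples n r ] (𝟙 (J Th σ ∧ (u ==ᵥ act t σ)) * f u)
      ≡⟨ ∑-cong (allTuples r r) (λ σ → ∑-cong (allTuples n r) (λ u →
           trans (cong (_* f u) (𝟙-∧ (J Th σ) _)) (*-assoc (𝟙 (J Th σ)) _ (f u)))) ⟩
    ∑[ σ ∈ allTuples r r ] ∑[ u ∈ allTuples n r ] (𝟙 (J Th σ) * (𝟙 (u ==ᵥ act t σ) * f u))
      ≡⟨ ∑-cong (allTuples r r) (λ σ → trans (∑-*ˡ (allTuples n r) (𝟙 (J Th σ)) _)
                                             (cong (𝟙 (J Th σ) *_) (Tuples.∑-δ f (act t σ)))) ⟩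
    ∑[ σ ∈ allTuples r r ] (𝟙 (J Th σ) * f (act t σ))
      ∎
    where
    open ≡-Reasoning
    at-most-one : ∀ u {σ σ′} → T (J Th σ ∧ (u ==ᵥ act t σ)) → T (J Th σ′ ∧ (u ==ᵥ act t σ′)) →
                  σ ≡ σ′
    at-most-one u {σ} {σ′} Jσ∧u≡tσ Jσ′∧u≡tσ′ =
      act-cancelˡ t t-inj (trans (sym (toWitness (proj₂ (Equivalence.to (T-∧ {J Th σ}) Jσ∧u≡tσ))))
                                 (toWitness (proj₂ (Equivalence.to (T-∧ {J Th σ′}) Jσ′∧u≡tσ′))))

  orbitSize≡mT : ∀ t → Injective _≡_ _≡_ (lookup t) → ∑[ u ∈ allTuples n r ] 𝟙 (inOrbit t u) ≡ mT Th
  orbitSize≡mT t t-inj = begin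
    ∑[ u ∈ allTuples n r ] 𝟙 (inOrbit t u)         ≡⟨ ∑-cong (allTuples n r) (λ u → sym (*-identityʳ _)) ⟩
    ∑[ u ∈ allTuples n r ] (𝟙 (inOrbit t u) * 1)   ≡⟨ ∑-orbit t t-inj (λ _ → 1) ⟩
    ∑[ σ ∈ allTuples r r ] (𝟙 (J Th σ) * 1)        ≡⟨ ∑-cong (allTuples r r) (λ σ → *-identityʳ _) ⟩
    ∑[ σ ∈ allTuples r r ] 𝟙 (J Th σ)              ≡⟨ count≡∑ (J Th) (allTuples r r) ⟨
    mT Th                                          ∎
    where open ≡-Reasoning

  entrySet-act : ∀ (t : Vec (Fin n) r) {σ} → T (J Th σ) → entrySet (act t σ) ≡ entrySet t
  entrySet-act t {σ} Jσ = tabulate-cong λ v →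
    T-⇔⇒≡ (entries-⊆ (act t σ) t (λ i → lookup σ i , lookup-act t σ i))
          (entries-⊆ t (act t σ) (λ i → lookup ρ i , moved i))
    where
    ρ = proj₁ (J-rightInverse Th Jσ)
    σρ≗id = proj₂ (proj₂ (J-rightInverse Th Jσ))

    moved : ∀ i → lookup t i ≡ lookup (act t σ) (lookup ρ i)
    moved i = trans (cong (lookup t) (sym (σρ≗id i))) (sym (lookup-act t σ (lookup ρ i)))

    entries-⊆ : ∀ {v} (u u′ : Vec (Fin n) r) → (∀ i → ∃ λ j → lookup u i ≡ lookup u′ j) →
                T (anyL (λ i → ⌊ v Fin.≟ lookup u i ⌋) (allFin r)) →
                T (anyL (λ i → ⌊ v Fin.≟ lookup u′ i ⌋) (allFin r))
    entries-⊆ u u′ u⊆u′ v∈u =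
      let i , v≡uᵢ = anyL-elim (allFin r) v∈u ; j , uᵢ≡u′ⱼ = u⊆u′ i in
      anyL-intro (∈-allFin j) (fromWitness (trans (toWitness v≡uᵢ) uᵢ≡u′ⱼ))

module _ {r : ℕ} {Th Th′ : GDH r} (J′⊆J : ∀ σ → T (J Th′ σ) → T (J Th σ)) {n : ℕ} where

  inOrbit-mono : ∀ {t u : Vec (Fin n) r} → T (inOrbit Th′ t u) → T (inOrbit Th t u)
  inOrbit-mono {t} {u} t~u =
    let σ , J′σ , u≡tσ = inOrbit-elim Th′ {t = t} {u = u} t~u in
    subst (T ∘ inOrbit Th t) (sym u≡tσ) (inOrbit-intro Th t (J′⊆J σ J′σ))

-- A union of J′-orbits containing exactly k of the m/m′ J′-orbits inside each J-orbit of injective tuples.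
record Selector {r : ℕ} (Th Th′ : GDH r) (k n : ℕ) : Set where
  field
    pick        : Vec (Fin n) r → Bool
    pick-closed : ∀ t {τ} → T (J Th′ τ) → T (pick t) → T (pick (act t τ))
    pick-count  : ∀ t → Injective _≡_ _≡_ (lookup t) →
                  ∑[ σ ∈ allTuples r r ] (𝟙 (J Th σ) * 𝟙 (pick (act t σ))) ≡ k * mT Th′

module _ {r : ℕ} {Th Th′ : GDH r} {k : ℕ} where

  selector : (∀ σ → T (J Th′ σ) → T (J Th σ)) → k * mT Th′ ≤ mT Th → ∀ n → Selector Th Th′ k n
  selector J′⊆J km′≤m n = record
    { pick        = chosen
    ; pick-closed = λ t {τ} J′τ → subst T (chosen-resp {t} {act t τ} (inOrbit-intro Th′ t J′τ))
    ; pick-count  = λ t t-inj →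
        trans (sym (∑-orbit Th t t-inj (𝟙 ∘ chosen)))
              (count-chosen t (mT Th′) (λ w t≈w → orbitSize≡mT Th′ w (inOrbit-injective Th t t-inj t≈w))
                            {{>-nonZero (mT-pos Th′)}} (≤-trans km′≤m (≤-reflexive (sym (orbitSize≡mT Th t t-inj)))))
    }
    where
    open Choice (tuples n r) (inOrbit Th) (inOrbit Th′) (inOrbit-isEquivalence Th) (inOrbit-isEquivalence Th′)
                (λ {t} {u} → inOrbit-mono {Th = Th} {Th′} J′⊆J {t = t} {u = u}) k

  comap : ∀ {m n} (f : Fin m → Fin n) → Injective _≡_ _≡_ f → Selector Th Th′ k n → Selector Th Th′ k m
  comap f f-inj sel = record
    { pick        = λ t → pick (Vec.map f t)
    ; pick-closed = λ t {τ} J′τ → subst (T ∘ pick) (sym (act-map f t τ)) ∘ pick-closed (Vec.map f t) J′τ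
    ; pick-count  = λ t t-inj →
        trans (∑-cong (allTuples r r) (λ σ → cong (λ u → 𝟙 (J Th σ) * 𝟙 (pick u)) (act-map f t σ)))
              (pick-count (Vec.map f t) (map-injective t t-inj))
    }
    where
    open Selector sel
    map-injective : ∀ t → Injective _≡_ _≡_ (lookup t) → Injective _≡_ _≡_ (lookup (Vec.map f t))
    map-injective t t-inj {i} {j} eq = t-inj (f-inj (trans (sym (lookup-map i f t)) (trans eq (lookup-map j f t))))

tupleCount : ∀ {n r} → (Vec (Fin n) r → Bool) → Vec Bool n → ℕ
tupleCount {n} {r} X R = ∑[ t ∈ allTuples n r ] 𝟙 (X t ∧ (entrySet t ==ₛ R))

module _ {r : ℕ} {Th Th′ : GDH r} {k n : ℕ} (G : TGraph Th n) (sel : Selector Th Th′ k n) where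
  open Selector sel
  open Classes (tuples n r) (inOrbit Th) (inOrbit-isEquivalence Th)

  tupleCount-pick : ∀ R → mT Th * tupleCount (λ t → E G t ∧ pick t) R ≡ k * mT Th′ * tupleCount (E G) R
  tupleCount-pick R = begin
    mT Th * tupleCount (λ t → E G t ∧ pick t) R ≡⟨ cong (mT Th *_) picked ⟩
    mT Th * (classCount Y * (k * mT Th′))       ≡⟨ x∙yz≈z∙yx (mT Th) (classCount Y) (k * mT Th′) ⟩
    k * mT Th′ * (classCount Y * mT Th)         ≡⟨ cong (k * mT Th′ *_) all ⟨
    k * mT Th′ * tupleCount (E G) R             ∎
    where
    open ≡-Reasoning
    Y : Vec (Fin n) r → Bool
    Y t = E G t ∧ (entrySet t ==ₛ R)

    Y-closed : ∀ {u v} → T (inOrbit Th u v) → T (Y u) → T (Y v)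
    Y-closed {u} {v} u~v Yu =
      let σ , Jσ , v≡uσ = inOrbit-elim Th {t = u} {u = v} u~v ; Eu , u∈R = Equivalence.to T-∧ Yu in
      subst (T ∘ Y) (sym v≡uσ)
            (Equivalence.from T-∧ (E-closed G u σ Eu Jσ , subst (λ S → T (S ==ₛ R)) (sym (entrySet-act Th u Jσ)) u∈R))

    Y-injective : ∀ {w} → T (Y w) → Injective _≡_ _≡_ (lookup w)
    Y-injective {w} = E-distinct G w ∘ proj₁ ∘ Equivalence.to T-∧

    picked : tupleCount (λ t → E G t ∧ pick t) R ≡ classCount Y * (k * mT Th′)
    picked = trans (∑-cong (allTuples n r) (λ t → 𝟙-∧-∧ (E G t) (pick t) _))
                   (∑-classes-const Y Y-closed (𝟙 ∘ pick) (k * mT Th′) λ w Yw →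
                      trans (∑-orbit Th w (Y-injective Yw) (𝟙 ∘ pick)) (pick-count w (Y-injective Yw)))

    all : tupleCount (E G) R ≡ classCount Y * mT Th
    all = trans (∑-cong (allTuples n r) (λ t → sym (*-identityʳ (𝟙 (Y t)))))
                (∑-classes-const Y Y-closed (λ _ → 1) (mT Th) λ w Yw →
                   trans (∑-cong (allTuples n r) (λ u → *-identityʳ _)) (orbitSize≡mT Th w (Y-injective Yw)))

-- Blowup densities

⟦_⟧ : ℕ → ℚ
⟦ a ⟧ = ℤ.+ a ℚ./ 1

⟦⟧≡fromℤ : ∀ a → ⟦ a ⟧ ≡ fromℤ (ℤ.+ a)
⟦⟧≡fromℤ a = ℚ.↥p/↧p≡p (fromℤ (ℤ.+ a))

⟦⟧-+ : ∀ a b → ⟦ a + b ⟧ ≡ ⟦ a ⟧ ℚ.+ ⟦ b ⟧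
⟦⟧-+ a b = sym (trans (cong₂ ℚ._+_ (⟦⟧≡fromℤ a) (⟦⟧≡fromℤ b))
                      (cong (ℚ._/ 1) (cong₂ ℤ._+_ (ℤ.*-identityʳ (ℤ.+ a)) (ℤ.*-identityʳ (ℤ.+ b)))))

⟦⟧-* : ∀ a b → ⟦ a * b ⟧ ≡ ⟦ a ⟧ ℚ.* ⟦ b ⟧
⟦⟧-* a b = sym (trans (cong₂ ℚ._*_ (⟦⟧≡fromℤ a) (⟦⟧≡fromℤ b)) (cong (ℚ._/ 1) (sym (ℤ.pos-* a b))))

⟦⟧-mono-≤ : ∀ {a b} → a ≤ b → ⟦ a ⟧ ℚ.≤ ⟦ b ⟧
⟦⟧-mono-≤ {a} {b} a≤b = subst₂ ℚ._≤_ (sym (⟦⟧≡fromℤ a)) (sym (⟦⟧≡fromℤ b))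
  (ℚ.*≤* (subst₂ ℤ._≤_ (sym (ℤ.*-identityʳ (ℤ.+ a))) (sym (ℤ.*-identityʳ (ℤ.+ b))) (ℤ.+≤+ a≤b)))

⟦⟧-mono-< : ∀ {a b} → a < b → ⟦ a ⟧ ℚ.< ⟦ b ⟧
⟦⟧-mono-< {a} {b} a<b = subst₂ ℚ._<_ (sym (⟦⟧≡fromℤ a)) (sym (⟦⟧≡fromℤ b))
  (ℚ.*<* (subst₂ ℤ._<_ (sym (ℤ.*-identityʳ (ℤ.+ a))) (sym (ℤ.*-identityʳ (ℤ.+ b))) (ℤ.+<+ a<b)))

⟦⟧-*-inv : ∀ m → .{{_ : NonZero m}} → ⟦ m ⟧ ℚ.* inv m ≡ 1ℚ
⟦⟧-*-inv (suc m) = trans (cong₂ ℚ._*_ (⟦⟧≡fromℤ (suc m)) (ℚ.↥p/↧p≡p (ℚ.1/ fromℤ (ℤ.+ suc m))))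
                         (ℚ.*-inverseʳ (fromℤ (ℤ.+ suc m)))

module _ {A : Set} where

  sumℚ-cong : ∀ xs {f g : A → ℚ} → (∀ x → f x ≡ g x) → sumℚ (List.map f xs) ≡ sumℚ (List.map g xs)
  sumℚ-cong []       f≗g = refl
  sumℚ-cong (x ∷ xs) f≗g = cong₂ ℚ._+_ (f≗g x) (sumℚ-cong xs f≗g)

  sumℚ-*ˡ : ∀ xs c (f : A → ℚ) → c ℚ.* sumℚ (List.map f xs) ≡ sumℚ (List.map (λ x → c ℚ.* f x) xs)
  sumℚ-*ˡ []       c f = ℚ.*-zeroʳ c
  sumℚ-*ˡ (x ∷ xs) c f = trans (ℚ.*-distribˡ-+ c (f x) _) (cong (c ℚ.* f x ℚ.+_) (sumℚ-*ˡ xs c f))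

  sumℚ-mono-≤ : ∀ xs {f g : A → ℚ} → (∀ x → f x ℚ.≤ g x) →
                sumℚ (List.map f xs) ℚ.≤ sumℚ (List.map g xs)
  sumℚ-mono-≤ []       f≤g = ℚ.≤-refl
  sumℚ-mono-≤ (x ∷ xs) f≤g = ℚ.+-mono-≤ (f≤g x) (sumℚ-mono-≤ xs f≤g)

  sumℚ-if : ∀ xs (b : A → Bool) c →
            sumℚ (List.map (λ x → if b x then c else 0ℚ) xs) ≡ ⟦ ∑[ x ∈ xs ] 𝟙 (b x) ⟧ ℚ.* c
  sumℚ-if []       b c = sym (ℚ.*-zeroˡ c)
  sumℚ-if (x ∷ xs) b c with b x
  ... | false = trans (ℚ.+-identityˡ _) (sumℚ-if xs b c)
  ... | true  = begin
    c ℚ.+ sumℚ (List.map (λ x → if b x then c else 0ℚ) xs) ≡⟨ cong (c ℚ.+_) (sumℚ-if xs b c) ⟩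
    c ℚ.+ ⟦ N ⟧ ℚ.* c                                      ≡⟨ cong (ℚ._+ ⟦ N ⟧ ℚ.* c) (ℚ.*-identityˡ c) ⟨
    1ℚ ℚ.* c ℚ.+ ⟦ N ⟧ ℚ.* c                               ≡⟨ ℚ.*-distribʳ-+ c 1ℚ ⟦ N ⟧ ⟨
    (1ℚ ℚ.+ ⟦ N ⟧) ℚ.* c                                   ≡⟨ cong (ℚ._* c) (⟦⟧-+ 1 N) ⟨
    ⟦ 1 + N ⟧ ℚ.* c                                        ∎
    where
    open ≡-Reasoning
    N = ∑[ x ∈ xs ] 𝟙 (b x)

prodOn-nonNeg : ∀ {n} (R : Vec Bool n) {x : Fin n → ℚ} → (∀ i → 0ℚ ℚ.≤ x i) → 0ℚ ℚ.≤ prodOn R x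
prodOn-nonNeg {n} R {x} x≥0 = go (allFin n)
  where
  factor-nonNeg : ∀ i → 0ℚ ℚ.≤ (if lookup R i then x i else 1ℚ)
  factor-nonNeg i with lookup R i
  ... | true  = x≥0 i
  ... | false = ⟦⟧-mono-≤ {0} {1} z≤n
  go : ∀ is → 0ℚ ℚ.≤ List.foldr ℚ._*_ 1ℚ (List.map (λ i → if lookup R i then x i else 1ℚ) is)
  go []       = ⟦⟧-mono-≤ {0} {1} z≤n
  go (i ∷ is) = ℚ.≤-trans (ℚ.≤-reflexive (sym (ℚ.*-zeroʳ factor)))
                          (ℚ.*-monoˡ-≤-nonNeg factor {{ℚ.nonNegative (factor-nonNeg i)}} (go is))
    where factor = if lookup R i then x i else 1ℚ

onLayer : ∀ {n} → ℕ → Vec Bool n → ℚ → ℚ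
onLayer r R q = if ⌊ card R ℕ.≟ r ⌋ then q else 0ℚ

onLayer-*ˡ : ∀ {n} r (R : Vec Bool n) c q → c ℚ.* onLayer r R q ≡ onLayer r R (c ℚ.* q)
onLayer-*ˡ r R c q with ⌊ card R ℕ.≟ r ⌋
... | true  = refl
... | false = ℚ.*-zeroʳ c

onLayer-mono-≤ : ∀ {n} r (R : Vec Bool n) {q q′} → q ℚ.≤ q′ → onLayer r R q ℚ.≤ onLayer r R q′
onLayer-mono-≤ r R q≤q′ with ⌊ card R ℕ.≟ r ⌋
... | true  = q≤q′
... | false = ℚ.≤-refl

polyOf : ∀ {n} (r : ℕ) → (Vec Bool n → ℕ) → (Fin n → ℚ) → ℚ
polyOf {n} r N x = sumℚ (List.map (λ R → onLayer r R (⟦ N R ⟧ ℚ.* prodOn R x)) (allSubsets n))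

module _ {n : ℕ} (r : ℕ) (x : Fin n → ℚ) where

  polyOf-cong : ∀ {N₁ N₂ : Vec Bool n → ℕ} → (∀ R → N₁ R ≡ N₂ R) → polyOf r N₁ x ≡ polyOf r N₂ x
  polyOf-cong N₁≗N₂ =
    sumℚ-cong (allSubsets n) (λ R → cong (λ c → onLayer r R (⟦ c ⟧ ℚ.* prodOn R x)) (N₁≗N₂ R))

  polyOf-*ˡ : ∀ c (N : Vec Bool n → ℕ) → ⟦ c ⟧ ℚ.* polyOf r N x ≡ polyOf r (λ R → c * N R) x
  polyOf-*ˡ c N = trans (sumℚ-*ˡ (allSubsets n) ⟦ c ⟧ _) (sumℚ-cong (allSubsets n) λ R →
    trans (onLayer-*ˡ r R ⟦ c ⟧ _)
          (cong (onLayer r R) (trans (sym (ℚ.*-assoc ⟦ c ⟧ ⟦ N R ⟧ _))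
                                     (cong (ℚ._* prodOn R x) (sym (⟦⟧-* c (N R)))))))

  polyOf-mono-≤ : (∀ i → 0ℚ ℚ.≤ x i) → ∀ {N₁ N₂ : Vec Bool n → ℕ} → (∀ R → N₁ R ≤ N₂ R) →
                  polyOf r N₁ x ℚ.≤ polyOf r N₂ x
  polyOf-mono-≤ x≥0 N₁≤N₂ = sumℚ-mono-≤ (allSubsets n) λ R →
    onLayer-mono-≤ r R (ℚ.*-monoʳ-≤-nonNeg (prodOn R x) {{ℚ.nonNegative (prodOn-nonNeg R x≥0)}}
                                           (⟦⟧-mono-≤ (N₁≤N₂ R)))

tupleCount-mono-≤ : ∀ {n r} {X Y : Vec (Fin n) r → Bool} → (∀ t → T (X t) → T (Y t)) →
                    ∀ R → tupleCount X R ≤ tupleCount Y R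
tupleCount-mono-≤ {n} {r} {X} {Y} X⊆Y R = ∑-mono-≤ (allTuples n r) λ t → 𝟙-mono (X t ∧ _) (Y t ∧ _) λ X∧R →
  let Xt , tR = Equivalence.to T-∧ X∧R in Equivalence.from T-∧ (X⊆Y t Xt , tR)

module _ {r n : ℕ} {Th : GDH r} (G : TGraph Th n) where

  -- Every edge is a J-orbit of m_T tuples, so m_T e_R counts the edge tuples with entry set R.
  edgeCount≡ : ∀ R → edgeCount G R ≡ ⟦ tupleCount (E G) R ⟧ ℚ.* inv (mT Th)
  edgeCount≡ R = trans (sumℚ-cong (allTuples n r) orbit-weight) (sumℚ-if (allTuples n r) _ (inv (mT Th)))
    where
    orbit-weight : ∀ t → (if E G t ∧ (entrySet t ==ₛ R) then inv (orbitSize Th t) else 0ℚ)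
                         ≡ (if E G t ∧ (entrySet t ==ₛ R) then inv (mT Th) else 0ℚ)
    orbit-weight t with E G t in Et
    ... | false = refl
    ... | true  = cong (λ m → if entrySet t ==ₛ R then inv m else 0ℚ)
                       (trans (count≡∑ (inOrbit Th t) (allTuples n r))
                              (orbitSize≡mT Th t (E-distinct G t (subst T (sym Et) tt))))

  blowupAt≡polyOf : ∀ x → blowupAt G x ≡ polyOf r (tupleCount (E G)) x
  blowupAt≡polyOf x = trans (sumℚ-*ˡ (allSubsets n) ⟦ mT Th ⟧ _) (sumℚ-cong (allSubsets n) λ R →
    trans (onLayer-*ˡ r R ⟦ mT Th ⟧ _) (cong (onLayer r R) (cancel-mT R)))
    where
    cancel-mT : ∀ R → ⟦ mT Th ⟧ ℚ.* (edgeCount G R ℚ.* prodOn R x) ≡ ⟦ tupleCount (E G) R ⟧ ℚ.* prodOn R x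
    cancel-mT R = begin
      m ℚ.* (edgeCount G R ℚ.* p)      ≡⟨ cong (λ e → m ℚ.* (e ℚ.* p)) (edgeCount≡ R) ⟩
      m ℚ.* (N ℚ.* inv (mT Th) ℚ.* p)  ≡⟨ ℚ.*-assoc m _ p ⟨
      m ℚ.* (N ℚ.* inv (mT Th)) ℚ.* p  ≡⟨ cong (ℚ._* p) (ℚ.*-assoc m N _) ⟨
      m ℚ.* N ℚ.* inv (mT Th) ℚ.* p    ≡⟨ cong (λ e → e ℚ.* inv (mT Th) ℚ.* p) (ℚ.*-comm m N) ⟩
      N ℚ.* m ℚ.* inv (mT Th) ℚ.* p    ≡⟨ cong (ℚ._* p) (ℚ.*-assoc N m _) ⟩
      N ℚ.* (m ℚ.* inv (mT Th)) ℚ.* p  ≡⟨ cong (λ e → N ℚ.* e ℚ.* p) (⟦⟧-*-inv (mT Th) {{m≢0}}) ⟩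
      N ℚ.* 1ℚ ℚ.* p                   ≡⟨ cong (ℚ._* p) (ℚ.*-identityʳ N) ⟩
      N ℚ.* p                          ∎
      where
      open ≡-Reasoning
      m = ⟦ mT Th ⟧
      N = ⟦ tupleCount (E G) R ⟧
      p = prodOn R x
      m≢0 = >-nonZero (mT-pos Th)

module _ {r n : ℕ} {Th : GDH r} where

  blowupAt-mono-≤ : ∀ (G H : TGraph Th n) → (∀ t → T (E G t) → T (E H t)) → ∀ {x} → (∀ i → 0ℚ ℚ.≤ x i) →
                    blowupAt G x ℚ.≤ blowupAt H x
  blowupAt-mono-≤ G H G⊆H {x} x≥0 = begin
    blowupAt G x                   ≡⟨ blowupAt≡polyOf G x ⟩
    polyOf r (tupleCount (E G)) x  ≤⟨ polyOf-mono-≤ r x x≥0 (tupleCount-mono-≤ G⊆H) ⟩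
    polyOf r (tupleCount (E H)) x  ≡⟨ blowupAt≡polyOf H x ⟨
    blowupAt H x                   ∎
    where open ℚ.≤-Reasoning

module _ {U : ℚ → Set} (cut : UpperCut01 U) {a b : ℕ} (0<a : 0 < a) (a≤b : a ≤ b) where
  open UpperCut01 cut

  private
    instance
      a-pos : ℚ.Positive ⟦ a ⟧
      a-pos = ℚ.positive (⟦⟧-mono-< 0<a)
      b-pos : ℚ.Positive ⟦ b ⟧
      b-pos = ℚ.positive (⟦⟧-mono-< (<-≤-trans 0<a a≤b))
      b-nonZero : ℚ.NonZero ⟦ b ⟧
      b-nonZero = ℚ.pos⇒nonZero ⟦ b ⟧
      b-nonNeg : ℚ.NonNegative ⟦ b ⟧
      b-nonNeg = ℚ.pos⇒nonNeg ⟦ b ⟧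

  upclosed-≤ : ∀ {s z} → U s → s ℚ.≤ z → U z
  upclosed-≤ Us s≤z = let s′ , s′<s , Us′ = rounded _ Us in upclosed _ s′ (ℚ.<-≤-trans s′<s s≤z) Us′

  scaleCut-reflect : ∀ {y z} → ⟦ b ⟧ ℚ.* y ℚ.≤ ⟦ a ⟧ ℚ.* z → ¬ U z → ¬ scaleCut a b U y
  scaleCut-reflect by≤az ¬Uz (s , Us , as≤by) =
    ¬Uz (upclosed-≤ Us (ℚ.*-cancelˡ-≤-pos ⟦ a ⟧ (ℚ.≤-trans as≤by by≤az)))

  scaleCut-upperCut : UpperCut01 (scaleCut a b U)
  scaleCut-upperCut = record
    { rounded  = λ q (s , Us , as≤bq) →
        let s′ , s′<s , Us′ = rounded s Us
            q′ = ℚ.1/ ⟦ b ⟧ ℚ.* (⟦ a ⟧ ℚ.* s′)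
            bq′≡as′ : ⟦ b ⟧ ℚ.* q′ ≡ ⟦ a ⟧ ℚ.* s′
            bq′≡as′ = trans (sym (ℚ.*-assoc ⟦ b ⟧ _ _))
                            (trans (cong (ℚ._* (⟦ a ⟧ ℚ.* s′)) (ℚ.*-inverseʳ ⟦ b ⟧)) (ℚ.*-identityˡ _))
        in q′ , ℚ.*-cancelˡ-<-nonNeg ⟦ b ⟧ (subst (ℚ._< ⟦ b ⟧ ℚ.* q) (sym bq′≡as′)
                                                   (ℚ.<-≤-trans (ℚ.*-monoʳ-<-pos ⟦ a ⟧ s′<s) as≤bq))
              , s′ , Us′ , ℚ.≤-reflexive (sym bq′≡as′)
    ; upclosed = λ q q′ q′<q (s , Us , as≤bq′) →
        s , Us , ℚ.≤-trans as≤bq′ (ℚ.*-monoˡ-≤-nonNeg ⟦ b ⟧ (ℚ.<⇒≤ q′<q))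
    ; below1   = 1ℚ , below1 ,
                 subst₂ ℚ._≤_ (sym (ℚ.*-identityʳ ⟦ a ⟧)) (sym (ℚ.*-identityʳ ⟦ b ⟧)) (⟦⟧-mono-≤ a≤b)
    ; nonneg   = scaleCut-reflect (ℚ.≤-reflexive (trans (ℚ.*-zeroʳ ⟦ b ⟧) (sym (ℚ.*-zeroʳ ⟦ a ⟧)))) nonneg
    }

restrict : ∀ {r n m} {Th : GDH r} → TGraph Th n → (Fin m → Fin n) → TGraph Th m
restrict G f = record
  { E          = λ t → E G (Vec.map f t)
  ; E-distinct = λ t Eft {i} {j} tᵢ≡tⱼ →
      E-distinct G (Vec.map f t) Eft (trans (lookup-map i f t) (trans (cong f tᵢ≡tⱼ) (sym (lookup-map j f t))))
  ; E-closed   = λ t σ Eft Jσ → subst (T ∘ E G) (sym (act-map f t σ)) (E-closed G (Vec.map f t) σ Eft Jσ)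
  }

module _ {r : ℕ} {Th Th′ : GDH r} (J′⊆J : ∀ σ → T (J Th′ σ) → T (J Th σ)) {k n : ℕ} where

  select : TGraph Th n → Selector Th Th′ k n → TGraph Th′ n
  select G sel = record
    { E          = λ t → E G t ∧ pick t
    ; E-distinct = λ t → E-distinct G t ∘ proj₁ ∘ Equivalence.to T-∧
    ; E-closed   = λ t τ Et∧pt J′τ → let Et , pt = Equivalence.to T-∧ Et∧pt in
        Equivalence.from T-∧ (E-closed G t τ Et (J′⊆J τ J′τ) , pick-closed t J′τ pt)
    }
    where open Selector sel

  blowupAt-select : ∀ (G : TGraph Th n) sel x →
                    ⟦ mT Th ⟧ ℚ.* blowupAt (select G sel) x ≡ ⟦ k * mT Th′ ⟧ ℚ.* blowupAt G x
  blowupAt-select G sel x = begin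
    ⟦ mT Th ⟧ ℚ.* blowupAt (select G sel) x
      ≡⟨ cong (⟦ mT Th ⟧ ℚ.*_) (blowupAt≡polyOf (select G sel) x) ⟩
    ⟦ mT Th ⟧ ℚ.* polyOf r (tupleCount (λ t → E G t ∧ pick t)) x
      ≡⟨ polyOf-*ˡ r x (mT Th) _ ⟩
    polyOf r (λ R → mT Th * tupleCount (λ t → E G t ∧ pick t) R) x
      ≡⟨ polyOf-cong r x (tupleCount-pick G sel) ⟩
    polyOf r (λ R → k * mT Th′ * tupleCount (E G) R) x
      ≡⟨ polyOf-*ˡ r x (k * mT Th′) _ ⟨
    ⟦ k * mT Th′ ⟧ ℚ.* polyOf r (tupleCount (E G)) x
      ≡⟨ cong (⟦ k * mT Th′ ⟧ ℚ.*_) (blowupAt≡polyOf G x) ⟨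
    ⟦ k * mT Th′ ⟧ ℚ.* blowupAt G x
      ∎
    where
    open ≡-Reasoning
    open Selector sel

module _ {r : ℕ} {Th Th′ : GDH r} (J′⊆J : ∀ σ → T (J Th′ σ) → T (J Th σ)) {k n : ℕ}
         (G : TGraph Th n) (sel : Selector Th Th′ k n) where

  restrictSub : SubTGraph (select J′⊆J G sel) → SubTGraph G
  restrictSub S′ = record
    { k = SubTGraph.k S′ ; emb = emb S′ ; emb-inj = emb-inj S′ ; H = restrict G (emb S′) ; H⊆G = λ _ Eft → Eft }

  blowupAt-sub : ∀ (S′ : SubTGraph (select J′⊆J G sel)) {x} → (∀ i → 0ℚ ℚ.≤ x i) →
                 ⟦ mT Th ⟧ ℚ.* blowupAt (H S′) x ℚ.≤ ⟦ k * mT Th′ ⟧ ℚ.* blowupAt (H (restrictSub S′)) x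
  blowupAt-sub S′ {x} x≥0 = begin
    ⟦ mT Th ⟧ ℚ.* blowupAt (H S′) x              ≤⟨ ℚ.*-monoˡ-≤-nonNeg ⟦ mT Th ⟧ {{m≥0}}
                                                      (blowupAt-mono-≤ (H S′) (select J′⊆J Gᶠ selᶠ) (H⊆G S′) x≥0) ⟩
    ⟦ mT Th ⟧ ℚ.* blowupAt (select J′⊆J Gᶠ selᶠ) x ≡⟨ blowupAt-select J′⊆J Gᶠ selᶠ x ⟩
    ⟦ k * mT Th′ ⟧ ℚ.* blowupAt Gᶠ x             ∎
    where
    open ℚ.≤-Reasoning
    Gᶠ = restrict G (emb S′)
    selᶠ = comap (emb S′) (emb-inj S′) sel
    m≥0 = ℚ.nonNegative (⟦⟧-mono-≤ {0} {mT Th} z≤n)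

mainTheorem12 : (r : ℕ) → 2 ≤ r → (Th Th' : GDH r)
    → (∀ σ → T (J Th' σ) → T (J Th σ))
    → (U : ℚ → Set) → DemonstratedNonjump Th U
    → (k : ℕ) → 1 ≤ k → k * mT Th' ≤ mT Th
    → DemonstratedNonjump Th' (scaleCut (k * mT Th') (mT Th) U)
mainTheorem12 r _ Th Th′ J′⊆J U (cut , Gs , above , locally-below) k 1≤k km′≤m =
  scaleCut-upperCut cut 0<km′ km′≤m ,
  (λ i → proj₁ (Gs i) , select J′⊆J (G i) (sel i)) ,
  (λ i → let x , x∈Δ , U[bx] = above i in
         x , x∈Δ , blowupAt (G i) x , U[bx] , ℚ.≤-reflexive (sym (blowupAt-select J′⊆J (G i) (sel i) x))) ,
  (λ l → let n₀ , small = locally-below l in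
         n₀ , λ i n₀≤i S′ |S′|≤l x x∈Δ →
           scaleCut-reflect cut 0<km′ km′≤m (blowupAt-sub J′⊆J (G i) (sel i) S′ (proj₁ x∈Δ))
                            (small i n₀≤i (restrictSub J′⊆J (G i) (sel i) S′) |S′|≤l x x∈Δ))
  where
  G : ∀ i → TGraph Th (proj₁ (Gs i))
  G i = proj₂ (Gs i)
  sel : ∀ i → Selector Th Th′ k (proj₁ (Gs i))
  sel i = selector J′⊆J km′≤m (proj₁ (Gs i))
  0<km′ : 0 < k * mT Th′
  0<km′ = *-mono-≤ 1≤k (mT-pos Th′)
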